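{- Let $M_0$ and $M_1$ be finite Kripke models of the form described in the context, with $x_1$ the root of $M_1$, let $P^+,P^-$ be finite sets of propositional variables, let $C_0$ be a cluster of final elements of $M_0$ and $w_0\in C_0$. If $(M_0,w_0)\xrightarrow[2]{(P^+,P^-)}(M_1,x_1)$, then $C_0$ matches every cluster of final elements of $M_1$.
   Context: Modal formulas use variables, $\bot,\land,\lor,\neg,\to,\Box$ ($\Diamond=\neg\Box\neg$); $v^+(\varphi),v^-(\varphi)$ are the variables occurring positively/negatively ($\neg$ and the antecedent of $\to$ swap polarity, $\Box$, $\land$, $\lor$ preserve it, $v^+(p)=\{p\}$, $v^-(p)=\emptyset$); $d(\varphi)$ is the modal depth. Kripke frames have reflexive transitive $R$. A cluster is an equivalence class of $xR^sy:\iff xRy\wedge yRx$; $y$ is final if $yRz$ implies $zRy$. Each $M_i=(W_i,R_i,\Vdash_i)$ ($i\in\{0,1\}$) is a finite model with a root $x_i$ ($x_iRy$ for all $y$) such that $W_i\setminus\{x_i\}$ is the disjoint union of finitely many (at least one) clusters of final elements, each element of a cluster seeing exactly the elements of its cluster. A $(P^+,P^-)$-formula is one with $v^\circ(\varphi)\subseteq P^\circ$ for $\circ\in\{+,-\}$. $(M_0,w_0)\xrightarrow[n]{(P^+,P^-)}(M_1,w_1)$ means every $(P^+,P^-)$-formula of modal depth $\le n$ true at $(M_0,w_0)$ is true at $(M_1,w_1)$. A cluster $C_0$ of $M_0$ matches a cluster $C_1$ of $M_1$ iff for every $u_0\in C_0$ there is $u_1\in C_1$ with $(M_0,u_0)\xrightarrow[0]{(P^+,P^-)}(M_1,u_1)$,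 and for every $u_1\in C_1$ there is $u_0\in C_0$ with $(M_0,u_0)\xrightarrow[0]{(P^+,P^-)}(M_1,u_1)$. -}

module Defs where

open import Data.Nat using (ℕ; zero; suc; _≤_; _⊔_)
open import Data.Fin using (Fin)
open import Data.Bool using (Bool; true)
open import Data.List using (List; []; _∷_; [_]; _++_)
open import Data.List.Membership.Propositional using (_∈_)
open import Data.List.Relation.Unary.All using (All)
open import Data.Product using (Σ; ∃; ∃-syntax; _×_)
open import Data.Empty using (⊥)
open import Data.Sum using (_⊎_)
open import Relation.Nullary using (¬_)
open import Relation.Binary.PropositionalEquality using (_≡_; _≢_)
open import Function.Bundles using (_⇔_)

Var : Set
Var = ℕ

infixr 6 _∧'_
infixr 5 _∨'_
infixr 4 _⇒'_

data Fm : Set where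
  var  : Var → Fm
  ⊥'   : Fm
  _∧'_ : Fm → Fm → Fm
  _∨'_ : Fm → Fm → Fm
  ¬'_  : Fm → Fm
  _⇒'_ : Fm → Fm → Fm
  □_   : Fm → Fm

mutual
  v⁺ : Fm → List Var
  v⁺ (var p)  = [ p ]
  v⁺ ⊥'       = []
  v⁺ (φ ∧' ψ) = v⁺ φ ++ v⁺ ψ
  v⁺ (φ ∨' ψ) = v⁺ φ ++ v⁺ ψ
  v⁺ (¬' φ)   = v⁻ φ
  v⁺ (φ ⇒' ψ) = v⁻ φ ++ v⁺ ψ
  v⁺ (□ φ)    = v⁺ φ

  v⁻ : Fm → List Var
  v⁻ (var p)  = []
  v⁻ ⊥'       = []
  v⁻ (φ ∧' ψ) = v⁻ φ ++ v⁻ ψ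
  v⁻ (φ ∨' ψ) = v⁻ φ ++ v⁻ ψ
  v⁻ (¬' φ)   = v⁺ φ
  v⁻ (φ ⇒' ψ) = v⁺ φ ++ v⁻ ψ
  v⁻ (□ φ)    = v⁻ φ

depth : Fm → ℕ
depth (var p)  = 0
depth ⊥'       = 0
depth (φ ∧' ψ) = depth φ ⊔ depth ψ
depth (φ ∨' ψ) = depth φ ⊔ depth ψ
depth (¬' φ)   = depth φ
depth (φ ⇒' ψ) = depth φ ⊔ depth ψ
depth (□ φ)    = suc (depth φ)

record Model : Set where
  field
    size : ℕ
    R    : Fin size → Fin size → Bool
    V    : Fin size → Var → Bool
    root : Fin size

module _ (M : Model) where
  open Model M

  W : Set
  W = Fin size

  _≺_ : W → W → Set
  w ≺ v = R w v ≡ true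

  _⊩_ : W → Fm → Set
  w ⊩ var p    = V w p ≡ true
  w ⊩ ⊥'       = ⊥
  w ⊩ (φ ∧' ψ) = (w ⊩ φ) × (w ⊩ ψ)
  w ⊩ (φ ∨' ψ) = (w ⊩ φ) ⊎ (w ⊩ ψ)
  w ⊩ (¬' φ)   = ¬ (w ⊩ φ)
  w ⊩ (φ ⇒' ψ) = (w ⊩ φ) → (w ⊩ ψ)
  w ⊩ (□ φ)    = ∀ v → w ≺ v → v ⊩ φ

  Final : W → Set
  Final y = ∀ z → y ≺ z → z ≺ y

  record IsGoodModel : Set where
    field
      reflexive  : ∀ w → w ≺ w
      transitive : ∀ u v w → u ≺ v → v ≺ w → u ≺ w
      root-sees  : ∀ y → root ≺ y
      nonroot-final : ∀ y → y ≢ root → Final y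
      nonroot-not-root : ∀ y → y ≢ root → ¬ (y ≺ root)
      nonempty : ∃[ y ] (y ≢ root)

  _≈ˢ_ : W → W → Set
  x ≈ˢ y = (x ≺ y) × (y ≺ x)

  IsCluster : (W → Set) → Set
  IsCluster C = ∃[ y ] (∀ u → C u ⇔ (y ≈ˢ u))

  IsFinalCluster : (W → Set) → Set
  IsFinalCluster C = IsCluster C × (∀ u → C u → Final u)

_⊆_ : List Var → List Var → Set
xs ⊆ ys = All (_∈ ys) xs

IsPFormula : List Var → List Var → Fm → Set
IsPFormula P⁺ P⁻ φ = (v⁺ φ ⊆ P⁺) × (v⁻ φ ⊆ P⁻)

Transfer : List Var → List Var → ℕ → (M₀ : Model) → W M₀ → (M₁ : Model) → W M₁ → Set
Transfer P⁺ P⁻ n M₀ w₀ M₁ w₁ =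
  ∀ φ → IsPFormula P⁺ P⁻ φ → depth φ ≤ n → _⊩_ M₀ w₀ φ → _⊩_ M₁ w₁ φ

Matches : List Var → List Var → (M₀ : Model) → (W M₀ → Set) → (M₁ : Model) → (W M₁ → Set) → Set
Matches P⁺ P⁻ M₀ C₀ M₁ C₁ =
  (∀ u₀ → C₀ u₀ → ∃[ u₁ ] (C₁ u₁ × Transfer P⁺ P⁻ 0 M₀ u₀ M₁ u₁)) ×
  (∀ u₁ → C₁ u₁ → ∃[ u₀ ] (C₀ u₀ × Transfer P⁺ P⁻ 0 M₀ u₀ M₁ u₁))

{-# OPTIONS --safe #-}
-- Let χ be the conjunction of the (P⁺,P⁻)-literals describing the valuation of a
-- world u, so that v ⊩ χ says exactly that every depth-0 (P⁺,P⁻)-formula true at u is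
-- true at v.  Inside a final cluster every successor of w₀ sees u₀, so w₀ ⊩ □◇χ(u₀);
-- transferred to the root of M₁ this yields, in every final cluster of M₁, a world
-- satisfying χ(u₀).  Conversely, for a world u₁ of M₁, the formula χ(u₁) with the roles
-- of P⁺ and P⁻ exchanged is such that □¬χ(u₁) is a (P⁺,P⁻)-formula; it fails at the root
-- of M₁, hence at w₀, which gives a successor of w₀ (so a member of C₀) satisfying χ(u₁).
module Submission where

open import Defs
open import Data.Bool using (Bool; true; false; _≟_)
open import Data.Fin.Properties using (any?; all?)
open import Data.List using (List; []; _∷_; map)
open import Data.List.Membership.Propositional using (_∈_)
open import Data.List.Relation.Unary.All using (All; []; _∷_; tabulate; lookup)
open import Data.List.Relation.Unary.All.Properties using (++⁺; ++⁻ˡ; ++⁻ʳ; map⁺; map⁻)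
open import Data.Nat using (suc; _≤_; z≤n; s≤s)
open import Data.Nat.Properties using (⊔-lub; m⊔n≤o⇒m≤o; m⊔n≤o⇒n≤o; ≤-trans)
open import Data.Product using (_×_; _,_; proj₁; proj₂; ∃-syntax; swap)
open import Data.Sum using (inj₁; inj₂)
open import Function using (id)
open import Function.Bundles using (_⇔_; mk⇔; Equivalence)
open import Relation.Binary.PropositionalEquality using (_≡_; refl)
open import Relation.Nullary using (Dec; no; ¬_)
open import Relation.Nullary.Decidable.Core
  using (_×-dec_; _⊎-dec_; _→-dec_; ¬?; decidable-stable)

⊩-dec : (M : Model) → ∀ w φ → Dec (_⊩_ M w φ)
⊩-dec M w (var p)  = Model.V M w p ≟ true
⊩-dec M w ⊥'       = no λ ()
⊩-dec M w (φ ∧' ψ) = ⊩-dec M w φ ×-dec ⊩-dec M w ψ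
⊩-dec M w (φ ∨' ψ) = ⊩-dec M w φ ⊎-dec ⊩-dec M w ψ
⊩-dec M w (¬' φ)   = ¬? (⊩-dec M w φ)
⊩-dec M w (φ ⇒' ψ) = ⊩-dec M w φ →-dec ⊩-dec M w ψ
⊩-dec M w (□ φ)    = all? λ v → (Model.R M w v ≟ true) →-dec ⊩-dec M v φ

¬□¬⇒◇ : (M : Model) → ∀ {u} φ → ¬ _⊩_ M u (□ (¬' φ)) → ∃[ v ] (_≺_ M u v × _⊩_ M v φ)
¬□¬⇒◇ M {u} φ ¬□¬φ =
  decidable-stable (any? λ v → (Model.R M u v ≟ true) ×-dec ⊩-dec M v φ)
    λ ¬◇φ → ¬□¬φ λ v u≺v v⊩φ → ¬◇φ (v , u≺v , v⊩φ)

module _ {P⁺ P⁻ : List Var} where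

  isPFormula-var : ∀ {p} → p ∈ P⁺ → IsPFormula P⁺ P⁻ (var p)
  isPFormula-var p∈P⁺ = p∈P⁺ ∷ [] , []

  module _ (φ ψ : Fm) where

    isPFormula-∧ : IsPFormula P⁺ P⁻ φ → IsPFormula P⁺ P⁻ ψ → IsPFormula P⁺ P⁻ (φ ∧' ψ)
    isPFormula-∧ (φ⁺ , φ⁻) (ψ⁺ , ψ⁻) = ++⁺ φ⁺ ψ⁺ , ++⁺ φ⁻ ψ⁻

    isPFormula-⇒ : IsPFormula P⁻ P⁺ φ → IsPFormula P⁺ P⁻ ψ → IsPFormula P⁺ P⁻ (φ ⇒' ψ)
    isPFormula-⇒ (φ⁺ , φ⁻) (ψ⁺ , ψ⁻) = ++⁺ φ⁻ ψ⁺ , ++⁺ φ⁺ ψ⁻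

    isPFormula-∧⁻ : IsPFormula P⁺ P⁻ (φ ∧' ψ) → IsPFormula P⁺ P⁻ φ × IsPFormula P⁺ P⁻ ψ
    isPFormula-∧⁻ (⁺ , ⁻) = (++⁻ˡ (v⁺ φ) ⁺ , ++⁻ˡ (v⁻ φ) ⁻) , (++⁻ʳ (v⁺ φ) ⁺ , ++⁻ʳ (v⁻ φ) ⁻)

    isPFormula-∨⁻ : IsPFormula P⁺ P⁻ (φ ∨' ψ) → IsPFormula P⁺ P⁻ φ × IsPFormula P⁺ P⁻ ψ
    isPFormula-∨⁻ = isPFormula-∧⁻

    isPFormula-⇒⁻ : IsPFormula P⁺ P⁻ (φ ⇒' ψ) → IsPFormula P⁻ P⁺ φ × IsPFormula P⁺ P⁻ ψ
    isPFormula-⇒⁻ (⁺ , ⁻) = (++⁻ˡ (v⁺ φ) ⁻ , ++⁻ˡ (v⁻ φ) ⁺) , (++⁻ʳ (v⁻ φ) ⁺ , ++⁻ʳ (v⁺ φ) ⁻)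

infix 4 _⊑[_,_]_

-- Atomic form of the transfer relation on valuations.
_⊑[_,_]_ : (Var → Bool) → List Var → List Var → (Var → Bool) → Set
f ⊑[ P⁺ , P⁻ ] g =
  (∀ {p} → p ∈ P⁺ → f p ≡ true → g p ≡ true) × (∀ {p} → p ∈ P⁻ → g p ≡ true → f p ≡ true)

⊑-refl : ∀ {P⁺ P⁻} f → f ⊑[ P⁺ , P⁻ ] f
⊑-refl f = (λ _ → id) , (λ _ → id)

-- A negation or an antecedent exchanges P⁺ with P⁻ and M₀ with M₁, hence the recursion
-- with the models swapped.
⊑⇒transfer₀ : ∀ {P⁺ P⁻} M₀ M₁ {u₀ u₁} →
  Model.V M₀ u₀ ⊑[ P⁺ , P⁻ ] Model.V M₁ u₁ → Transfer P⁺ P⁻ 0 M₀ u₀ M₁ u₁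
⊑⇒transfer₀ M₀ M₁ (up , _) (var p) (p∈P⁺ ∷ [] , []) _ = up p∈P⁺
⊑⇒transfer₀ M₀ M₁ ⊑ ⊥' _ _ ()
⊑⇒transfer₀ M₀ M₁ ⊑ (φ ∧' ψ) isP d (h₁ , h₂) =
  let φ-isP , ψ-isP = isPFormula-∧⁻ φ ψ isP in
  ⊑⇒transfer₀ M₀ M₁ ⊑ φ φ-isP (m⊔n≤o⇒m≤o _ _ d) h₁ ,
  ⊑⇒transfer₀ M₀ M₁ ⊑ ψ ψ-isP (m⊔n≤o⇒n≤o _ _ d) h₂
⊑⇒transfer₀ M₀ M₁ ⊑ (φ ∨' ψ) isP d (inj₁ h) =
  inj₁ (⊑⇒transfer₀ M₀ M₁ ⊑ φ (proj₁ (isPFormula-∨⁻ φ ψ isP)) (m⊔n≤o⇒m≤o _ _ d) h)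
⊑⇒transfer₀ M₀ M₁ ⊑ (φ ∨' ψ) isP d (inj₂ h) =
  inj₂ (⊑⇒transfer₀ M₀ M₁ ⊑ ψ (proj₂ (isPFormula-∨⁻ φ ψ isP)) (m⊔n≤o⇒n≤o _ _ d) h)
⊑⇒transfer₀ M₀ M₁ ⊑ (¬' φ) isP d h h₁ = h (⊑⇒transfer₀ M₁ M₀ (swap ⊑) φ (swap isP) d h₁)
⊑⇒transfer₀ M₀ M₁ ⊑ (φ ⇒' ψ) isP d h h₁ =
  let φ-isP , ψ-isP = isPFormula-⇒⁻ φ ψ isP in
  ⊑⇒transfer₀ M₀ M₁ ⊑ ψ ψ-isP (m⊔n≤o⇒n≤o _ _ d)
    (h (⊑⇒transfer₀ M₁ M₀ (swap ⊑) φ φ-isP (m⊔n≤o⇒m≤o _ _ d) h₁))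
⊑⇒transfer₀ M₀ M₁ ⊑ (□ φ) _ ()

⊤' : Fm
⊤' = ⊥' ⇒' ⊥'

⌜_⌝ : Bool → Fm
⌜ true ⌝  = ⊤'
⌜ false ⌝ = ⊥'

⊩⌜⌝⇔ : (M : Model) → ∀ w b → _⊩_ M w ⌜ b ⌝ ⇔ b ≡ true
⊩⌜⌝⇔ M w true  = mk⇔ (λ _ → refl) (λ _ → id)
⊩⌜⌝⇔ M w false = mk⇔ (λ ()) (λ ())

isPFormula-⌜⌝ : ∀ {P⁺ P⁻} b → IsPFormula P⁺ P⁻ ⌜ b ⌝
isPFormula-⌜⌝ true  = [] , []
isPFormula-⌜⌝ false = [] , []

depth-⌜⌝ : ∀ b → depth ⌜ b ⌝ ≤ 0
depth-⌜⌝ true  = z≤n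
depth-⌜⌝ false = z≤n

⋀ : List Fm → Fm
⋀ []       = ⊤'
⋀ (φ ∷ φs) = φ ∧' ⋀ φs

module _ (M : Model) {w : W M} where

  ⊩-⋀⁺ : ∀ {φs} → All (_⊩_ M w) φs → _⊩_ M w (⋀ φs)
  ⊩-⋀⁺ []       = id
  ⊩-⋀⁺ (h ∷ hs) = h , ⊩-⋀⁺ hs

  ⊩-⋀⁻ : ∀ φs → _⊩_ M w (⋀ φs) → All (_⊩_ M w) φs
  ⊩-⋀⁻ []       _        = []
  ⊩-⋀⁻ (φ ∷ φs) (h , hs) = h ∷ ⊩-⋀⁻ φs hs

isPFormula-⋀ : ∀ {P⁺ P⁻} φs → All (IsPFormula P⁺ P⁻) φs → IsPFormula P⁺ P⁻ (⋀ φs)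
isPFormula-⋀ []       []           = [] , []
isPFormula-⋀ (φ ∷ φs) (isP ∷ isPs) = isPFormula-∧ φ (⋀ φs) isP (isPFormula-⋀ φs isPs)

depth-⋀ : ∀ {n} φs → All (λ φ → depth φ ≤ n) φs → depth (⋀ φs) ≤ n
depth-⋀ []       []       = z≤n
depth-⋀ (φ ∷ φs) (d ∷ ds) = ⊔-lub d (depth-⋀ φs ds)

module _ (P⁺ P⁻ : List Var) (f : Var → Bool) where

  literal⁺ literal⁻ : Var → Fm
  literal⁺ p = ⌜ f p ⌝ ⇒' var p
  literal⁻ p = var p ⇒' ⌜ f p ⌝

  literals⁺ literals⁻ : List Fm
  literals⁺ = map literal⁺ P⁺
  literals⁻ = map literal⁻ P⁻

  χ : Fm
  χ = ⋀ literals⁺ ∧' ⋀ literals⁻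

  isPFormula-χ : IsPFormula P⁺ P⁻ χ
  isPFormula-χ = isPFormula-∧ (⋀ literals⁺) (⋀ literals⁻)
    (isPFormula-⋀ literals⁺ (map⁺ (tabulate λ {p} p∈P⁺ →
      isPFormula-⇒ ⌜ f p ⌝ (var p) (isPFormula-⌜⌝ (f p)) (isPFormula-var p∈P⁺))))
    (isPFormula-⋀ literals⁻ (map⁺ (tabulate λ {p} p∈P⁻ →
      isPFormula-⇒ (var p) ⌜ f p ⌝ (isPFormula-var p∈P⁻) (isPFormula-⌜⌝ (f p)))))

  depth-χ : depth χ ≤ 0
  depth-χ = ⊔-lub
    (depth-⋀ literals⁺ (map⁺ (tabulate λ {p} _ → ⊔-lub (depth-⌜⌝ (f p)) z≤n)))
    (depth-⋀ literals⁻ (map⁺ (tabulate λ {p} _ → depth-⌜⌝ (f p))))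

  ⊩χ⇔⊑ : (M : Model) → ∀ v → _⊩_ M v χ ⇔ f ⊑[ P⁺ , P⁻ ] Model.V M v
  ⊩χ⇔⊑ M v = mk⇔
    (λ (h⁺ , h⁻) →
      (λ p∈P⁺ fp → lookup (map⁻ (⊩-⋀⁻ M literals⁺ h⁺)) p∈P⁺ (from (⊩⌜⌝⇔ M v _) fp)) ,
      (λ p∈P⁻ vp → to (⊩⌜⌝⇔ M v _) (lookup (map⁻ (⊩-⋀⁻ M literals⁻ h⁻)) p∈P⁻ vp)))
    (λ (up , down) →
      ⊩-⋀⁺ M (map⁺ (tabulate λ p∈P⁺ c → up p∈P⁺ (to (⊩⌜⌝⇔ M v _) c))) ,
      ⊩-⋀⁺ M (map⁺ (tabulate λ p∈P⁻ vp → from (⊩⌜⌝⇔ M v _) (down p∈P⁻ vp))))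
    where open Equivalence

module FinalCluster (M : Model)
  (≺-refl : ∀ w → _≺_ M w w)
  (≺-trans : ∀ u v w → _≺_ M u v → _≺_ M v w → _≺_ M u w)
  {C : W M → Set} (C-final : IsFinalCluster M C) where

  rep : W M
  rep = proj₁ (proj₁ C-final)

  private
    ∈C⇔rep≈ˢ : ∀ u → C u ⇔ _≈ˢ_ M rep u
    ∈C⇔rep≈ˢ = proj₂ (proj₁ C-final)

    open module ∈C⇔rep≈ˢ {u} = Equivalence (∈C⇔rep≈ˢ u) using (to; from)

  rep∈C : C rep
  rep∈C = from (≺-refl rep , ≺-refl rep)

  connected : ∀ {a b} → C a → C b → _≺_ M a b
  connected {a} {b} a∈C b∈C = ≺-trans a rep b (proj₂ (to a∈C)) (proj₁ (to b∈C))

  upward-closed : ∀ {a b} → C a → _≺_ M a b → C b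
  upward-closed {a} {b} a∈C a≺b =
    let rep≺a , a≺rep = to a∈C in
    from (≺-trans rep a b rep≺a a≺b , ≺-trans b a rep (proj₂ C-final a a∈C b a≺b) a≺rep)

module _ {P⁺ P⁻ : List Var} (M₀ M₁ : Model) {w₀ : W M₀} {r : W M₁} where

  transfer-forth : ∀ {n u₀ y} → Transfer P⁺ P⁻ (suc (suc n)) M₀ w₀ M₁ r →
    (∀ v → _≺_ M₀ w₀ v → _≺_ M₀ v u₀) → _≺_ M₁ r y →
    ∃[ u₁ ] (_≺_ M₁ y u₁ × Transfer P⁺ P⁻ 0 M₀ u₀ M₁ u₁)
  transfer-forth {u₀ = u₀} {y} T all-see-u₀ r≺y =
    let u₁ , y≺u₁ , u₁⊩χ = ¬□¬⇒◇ M₁ χ₀ (T □◇χ₀ (isPFormula-χ P⁺ P⁻ f₀)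
                                          (s≤s (s≤s (≤-trans (depth-χ P⁺ P⁻ f₀) z≤n))) w₀⊩□◇χ₀ y r≺y)
    in u₁ , y≺u₁ , ⊑⇒transfer₀ M₀ M₁ (Equivalence.to (⊩χ⇔⊑ P⁺ P⁻ f₀ M₁ u₁) u₁⊩χ)
    where
    f₀ : Var → Bool
    f₀ = Model.V M₀ u₀
    χ₀ □◇χ₀ : Fm
    χ₀ = χ P⁺ P⁻ f₀
    □◇χ₀ = □ (¬' (□ (¬' χ₀)))
    w₀⊩□◇χ₀ : _⊩_ M₀ w₀ □◇χ₀
    w₀⊩□◇χ₀ v w₀≺v v⊩□¬χ₀ =
      v⊩□¬χ₀ u₀ (all-see-u₀ v w₀≺v) (Equivalence.from (⊩χ⇔⊑ P⁺ P⁻ f₀ M₀ u₀) (⊑-refl f₀))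

  -- χ₁ is built with P⁺ and P⁻ exchanged, so that □ ¬ χ₁ is a (P⁺,P⁻)-formula.
  transfer-back : ∀ {n u₁} → Transfer P⁺ P⁻ (suc n) M₀ w₀ M₁ r → _≺_ M₁ r u₁ →
    ∃[ u₀ ] (_≺_ M₀ w₀ u₀ × Transfer P⁺ P⁻ 0 M₀ u₀ M₁ u₁)
  transfer-back {u₁ = u₁} T r≺u₁ =
    let u₀ , w₀≺u₀ , u₀⊩χ = ¬□¬⇒◇ M₀ χ₁ λ w₀⊩□¬χ₁ →
          T (□ (¬' χ₁)) (swap (isPFormula-χ P⁻ P⁺ f₁)) (s≤s (≤-trans (depth-χ P⁻ P⁺ f₁) z≤n))
            w₀⊩□¬χ₁ u₁ r≺u₁ (Equivalence.from (⊩χ⇔⊑ P⁻ P⁺ f₁ M₁ u₁) (⊑-refl f₁))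
    in u₀ , w₀≺u₀ , ⊑⇒transfer₀ M₀ M₁ (swap (Equivalence.to (⊩χ⇔⊑ P⁻ P⁺ f₁ M₀ u₀) u₀⊩χ))
    where
    f₁ : Var → Bool
    f₁ = Model.V M₁ u₁
    χ₁ : Fm
    χ₁ = χ P⁻ P⁺ f₁

lemma4p3 : (M₀ M₁ : Model) → IsGoodModel M₀ → IsGoodModel M₁ →
    (P⁺ P⁻ : List Var) →
    (C₀ : W M₀ → Set) → IsFinalCluster M₀ C₀ →
    (w₀ : W M₀) → C₀ w₀ →
    Transfer P⁺ P⁻ 2 M₀ w₀ M₁ (Model.root M₁) →
    (C₁ : W M₁ → Set) → IsFinalCluster M₁ C₁ →
    Matches P⁺ P⁻ M₀ C₀ M₁ C₁
lemma4p3 M₀ M₁ G₀ G₁ P⁺ P⁻ C₀ C₀-final w₀ w₀∈C₀ T C₁ C₁-final = forth , back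
  where
  open IsGoodModel
  module C₀ = FinalCluster M₀ (reflexive G₀) (transitive G₀) C₀-final
  module C₁ = FinalCluster M₁ (reflexive G₁) (transitive G₁) C₁-final

  forth : ∀ u₀ → C₀ u₀ → ∃[ u₁ ] (C₁ u₁ × Transfer P⁺ P⁻ 0 M₀ u₀ M₁ u₁)
  forth u₀ u₀∈C₀ =
    let u₁ , rep≺u₁ , T₀ = transfer-forth M₀ M₁ T
          (λ v w₀≺v → C₀.connected (C₀.upward-closed w₀∈C₀ w₀≺v) u₀∈C₀) (root-sees G₁ C₁.rep)
    in u₁ , C₁.upward-closed C₁.rep∈C rep≺u₁ , T₀

  back : ∀ u₁ → C₁ u₁ → ∃[ u₀ ] (C₀ u₀ × Transfer P⁺ P⁻ 0 M₀ u₀ M₁ u₁)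
  back u₁ _ =
    let u₀ , w₀≺u₀ , T₀ = transfer-back M₀ M₁ T (root-sees G₁ u₁)
    in u₀ , C₀.upward-closed w₀∈C₀ w₀≺u₀ , T₀
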